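{- Let $K=\{k_1,\ldots,k_t\}$ be a finite set of Wang tiles with relations $T_R,T_D\subseteq K\times K$ such that there exists a tiling $C:\mathbb{Z}\times\mathbb{Z}\to K$ with $T_R(C(x,y),C(x+1,y))$ and $T_D(C(x,y),C(x,y+1))$ for all $x,y\in\mathbb{Z}$, but no such tiling is periodic. Let $\phi_2$ be the sentence described in the context, built from $K$. If $G$ is a finite model of $\phi_2$ whose Gaifman graph with respect to $L,R,U,D$ is connected, then $G$, restricted to $L,R,U,D$, is isomorphic to a rectangular grid.
   Context: A tiling $C:\mathbb{Z}\times\mathbb{Z}\to K$ is periodic if there is $(x_0,y_0)\ne(0,0)$ with $C(x,y)=C(x+x_0,y+y_0)$ for all $x,y$. A rectangular grid is a structure $(V,L,R,U,D)$ with $V=\{0,\ldots,x^*\}\times\{0,\ldots,y^*\}$ for some integers $x^*,y^*\ge0$, where the binary relations hold exactly in the cases (whenever both vertices exist) $L((x,y),(x-1,y))$, $R((x,y),(x+1,y))$, $U((x,y),(x,y-1))$, $D((x,y),(x,y+1))$. The signature consists of binary $L,R,U,D$, unary $B_V,B_H$, and one unary relation symbol (also denoted $k$) for each tile $k\in K$. $\phi_2$ is the conjunction of $\phi_1$ and the tiling axioms, where $\phi_1$ is the conjunction of: (Partial functionality) for each $X\in\{L,R,U,D\}$, $\forall x\forall y\forall z\,(X(x,y)\wedge X(x,z)\Rightarrow y=z)$, writing $X(x)$ for the unique such $y$; (Inverses) $R(x,y)\iff L(y,x)$ and $U(x,y)\iff D(y,x)$ for all $x,y$; (Commutativity) for $H\in\{L,R\}$,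 $V\in\{U,D\}$: $\forall x\forall y\forall z\,(H(x,y)\wedge V(x,z)\Rightarrow\exists t\,(H(z,t)\wedge V(y,t)))$; (Horizontal counter) $\forall x\,((\neg\exists y\,U(x,y))\Rightarrow\neg B_V(x))$, $\forall x\,((\exists y\,U(x,y))\Rightarrow((B_V(x)\not\iff B_V(U(x)))\iff C(x)))$ with $C(x)\equiv(\neg\exists y\,L(x,y))\vee(\neg B_V(L(x))\wedge B_V(U(L(x))))$, and $\forall x\,((\neg\exists y\,R(x,y))\Rightarrow\neg B_V(x))$; (Vertical counter) $\forall x\,((\neg\exists y\,R(x,y))\Rightarrow\neg B_H(x))$, $\forall x\,((\exists y\,R(x,y))\Rightarrow((B_H(x)\not\iff B_H(R(x)))\iff C'(x)))$ with $C'(x)\equiv(\neg\exists y\,D(x,y))\vee(\neg B_H(D(x))\wedge B_H(R(D(x))))$, and $\forall x\,((\neg\exists y\,U(x,y))\Rightarrow\neg B_H(x))$. The tiling axioms are: (Full tiling) every element satisfies exactly one tile relation $k\in K$; (Correct tiling) for all $k_1,k_2\in K$ with $\neg T_R(k_1,k_2)$: $\neg\exists v\,(k_1(v)\wedge k_2(R(v)))$, and for all $k_1,k_2$ with $\neg T_D(k_1,k_2)$: $\neg\exists v\,(k_1(v)\wedge k_2(D(v)))$. -}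

module Defs where

open import Data.Nat using (ℕ; suc)
open import Data.Fin using (Fin; toℕ)
open import Data.Bool using (Bool; true; false)
open import Data.Integer using (ℤ) renaming (_+_ to _+ℤ_; 0ℤ to 0ℤ; 1ℤ to 1ℤ)
open import Data.Product using (Σ; _×_; _,_)
open import Data.Sum using (_⊎_)
open import Relation.Nullary using (¬_)
open import Relation.Binary.PropositionalEquality using (_≡_)
open import Relation.Binary.Construct.Closure.ReflexiveTransitive using (Star)
open import Function.Bundles using (_↔_; Inverse)

infix 3 _⟺_
_⟺_ : Set → Set → Set
A ⟺ B = (A → B) × (B → A)

-- Wang tiles: K = Fin t, relations T_R, T_D ⊆ K × K given as Boolean matrices

IsTiling : ∀ {t} (TR TD : Fin t → Fin t → Bool) → (ℤ → ℤ → Fin t) → Set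
IsTiling TR TD C =
  ∀ x y → (TR (C x y) (C (x +ℤ 1ℤ) y) ≡ true) × (TD (C x y) (C x (y +ℤ 1ℤ)) ≡ true)

Periodic : ∀ {t} → (ℤ → ℤ → Fin t) → Set
Periodic C = Σ ℤ λ x0 → Σ ℤ λ y0 →
  ¬ (x0 ≡ 0ℤ × y0 ≡ 0ℤ) × (∀ x y → C x y ≡ C (x +ℤ x0) (y +ℤ y0))

-- The domain is Fin (suc n): finite and nonempty (first-order structures
-- have nonempty domains).

record Structure (t : ℕ) : Set where
  field
    n : ℕ
    L R U D : Fin (suc n) → Fin (suc n) → Bool
    BV BH : Fin (suc n) → Bool
    tile : Fin t → Fin (suc n) → Bool

  Carrier : Set
  Carrier = Fin (suc n)

module _ {t : ℕ} (G : Structure t) where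
  open Structure G

  Def : (Carrier → Carrier → Bool) → Carrier → Set
  Def X x = Σ Carrier λ y → X x y ≡ true

  PartialFun : (Carrier → Carrier → Bool) → Set
  PartialFun X = ∀ x y z → X x y ≡ true → X x z ≡ true → y ≡ z

  Commutes : (Carrier → Carrier → Bool) → (Carrier → Carrier → Bool) → Set
  Commutes H V = ∀ x y z → H x y ≡ true → V x z ≡ true →
    Σ Carrier λ w → (H z w ≡ true) × (V y w ≡ true)

  -- Atoms with function terms P(X(x)), P(Y(X(x))) are read as
  -- ∃ y (X(x,y) ∧ P(y)), ∃ y z (X(x,y) ∧ Y(y,z) ∧ P(z)).
  At1 : (Carrier → Bool) → (Carrier → Carrier → Bool) → Carrier → Set
  At1 P X x = Σ Carrier λ y → (X x y ≡ true) × (P y ≡ true)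

  At2 : (Carrier → Bool) → (Carrier → Carrier → Bool) → (Carrier → Carrier → Bool) → Carrier → Set
  At2 P X Y x = Σ Carrier λ y → Σ Carrier λ z → (X x y ≡ true) × (Y y z ≡ true) × (P z ≡ true)

  Cond : Carrier → Set
  Cond x = ¬ Def L x ⊎ (¬ At1 BV L x × At2 BV L U x)

  Cond' : Carrier → Set
  Cond' x = ¬ Def D x ⊎ (¬ At1 BH D x × At2 BH D R x)

  record Phi1 : Set where
    field
      pfL : PartialFun L
      pfR : PartialFun R
      pfU : PartialFun U
      pfD : PartialFun D
      invRL : ∀ x y → (R x y ≡ true) ⟺ (L y x ≡ true)
      invUD : ∀ x y → (U x y ≡ true) ⟺ (D y x ≡ true)
      comLU : Commutes L U
      comLD : Commutes L D
      comRU : Commutes R U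
      comRD : Commutes R D
      hc1 : ∀ x → ¬ Def U x → ¬ (BV x ≡ true)
      hc2 : ∀ x → Def U x → (¬ ((BV x ≡ true) ⟺ At1 BV U x)) ⟺ Cond x
      hc3 : ∀ x → ¬ Def R x → ¬ (BV x ≡ true)
      vc1 : ∀ x → ¬ Def R x → ¬ (BH x ≡ true)
      vc2 : ∀ x → Def R x → (¬ ((BH x ≡ true) ⟺ At1 BH R x)) ⟺ Cond' x
      vc3 : ∀ x → ¬ Def U x → ¬ (BH x ≡ true)

  record Phi2 (TR TD : Fin t → Fin t → Bool) : Set where
    field
      phi1 : Phi1
      tiled : ∀ v → Σ (Fin t) λ k → tile k v ≡ true
      tiledUnique : ∀ v k k' → tile k v ≡ true → tile k' v ≡ true → k ≡ k'
      correctR : ∀ k₁ k₂ → ¬ (TR k₁ k₂ ≡ true) →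
        ¬ (Σ Carrier λ v → Σ Carrier λ w → (R v w ≡ true) × (tile k₁ v ≡ true) × (tile k₂ w ≡ true))
      correctD : ∀ k₁ k₂ → ¬ (TD k₁ k₂ ≡ true) →
        ¬ (Σ Carrier λ v → Σ Carrier λ w → (D v w ≡ true) × (tile k₁ v ≡ true) × (tile k₂ w ≡ true))

  -- Gaifman graph w.r.t. L,R,U,D (loops irrelevant for connectivity)
  Rel1 : Carrier → Carrier → Set
  Rel1 a b = (L a b ≡ true) ⊎ (R a b ≡ true) ⊎ (U a b ≡ true) ⊎ (D a b ≡ true)

  Adj : Carrier → Carrier → Set
  Adj a b = Rel1 a b ⊎ Rel1 b a

  GaifmanConnected : Set
  GaifmanConnected = ∀ a b → Star Adj a b

GridV : ℕ → ℕ → Set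
GridV xs ys = Fin (suc xs) × Fin (suc ys)

module _ {xs ys : ℕ} where
  GridL GridR GridU GridD : GridV xs ys → GridV xs ys → Set
  GridL (x , y) (x' , y') = (toℕ x ≡ suc (toℕ x')) × (toℕ y ≡ toℕ y')
  GridR (x , y) (x' , y') = (toℕ x' ≡ suc (toℕ x)) × (toℕ y ≡ toℕ y')
  GridU (x , y) (x' , y') = (toℕ x ≡ toℕ x') × (toℕ y ≡ suc (toℕ y'))
  GridD (x , y) (x' , y') = (toℕ x ≡ toℕ x') × (toℕ y' ≡ suc (toℕ y))

IsoToGrid : ∀ {t} → Structure t → Set
IsoToGrid G = Σ ℕ λ xs → Σ ℕ λ ys → Σ (Carrier ↔ GridV xs ys) λ f →
  let open Inverse f using (to) in
  ∀ a b → ((L a b ≡ true) ⟺ GridL (to a) (to b))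
        × ((R a b ≡ true) ⟺ GridR (to a) (to b))
        × ((U a b ≡ true) ⟺ GridU (to a) (to b))
        × ((D a b ≡ true) ⟺ GridD (to a) (to b))
  where open Structure G

module Submission where

open import Defs
open import Data.Bool using (Bool; true; false)
open import Data.Bool.Properties using () renaming (_≟_ to _≟ᵇ_)
open import Data.Empty using (⊥; ⊥-elim)
open import Data.Fin using (Fin; toℕ; fromℕ<) renaming (zero to fzero)
open import Data.Fin.Properties using (any?; pigeonhole; toℕ<n; toℕ-fromℕ<; toℕ-injective)
open import Data.Integer using (ℤ; +_; -[1+_]; 0ℤ; 1ℤ) renaming (_+_ to _+ℤ_)
import Data.Integer.Properties as ℤ
open import Data.Nat using (ℕ; zero; suc; _+_; _≤_; _<_; z≤n; s≤s)
open import Data.Nat.Properties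
  using (_≟_; +-suc; +-comm; +-identityʳ; m≤n⇒∃[o]m+o≡n; m<m+n; <-cmp; <⇒≤; ≤-refl; ≤-pred;
         ≤∧≢⇒<)
open import Data.Product using (Σ; _×_; _,_; proj₁; proj₂; map₁; map₂)
open import Data.Sum using (_⊎_; inj₁; inj₂)
open import Function using (id; _∘_)
open import Function.Bundles using (_↔_; mk↔ₛ′)
open import Relation.Binary.Construct.Closure.ReflexiveTransitive using (Star; ε; _◅_)
open import Relation.Binary.Definitions using (tri<; tri≈; tri>)
open import Relation.Binary.PropositionalEquality
  using (_≡_; refl; sym; trans; cong; cong₂; subst; subst₂; module ≡-Reasoning)
open import Relation.Nullary using (¬_; yes; no; Dec; ¬?)

-- All relations L,R,U,D of a model G of φ₂ are partial injective
-- functions, R = L⁻¹, D = U⁻¹, and horizontal and vertical steps commute.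
-- (1) G has a corner o without L- and U-neighbour.  Otherwise three cases arise.
--     If L and U are total, G is a finite torus and unrolling it gives a
--     periodic tiling of ℤ², contradicting aperiodicity.  In the two mixed cases
--     some row (or column) of G closes into a cycle while the bits B_V (or B_H)
--     form a binary counter along it whose most significant digit is constantly
--     0: such a counter has all digits constant, yet its least significant digit
--     must toggle at every step.
-- (2) From the corner, walk j steps down and then i steps right.  Since walks
--     from o cannot cycle, they end after a steps right and b steps down;
--     commutativity and connectedness show that every element is reached by
--     exactly one such pair (i , j) ≤ (a , b), and that L,R,U,D are the grid
--     relations in these coordinates.

infixl 5 _▷_
data Walk {A : Set} (X : A → A → Bool) : ℕ → A → A → Set where
  []  : ∀ {x} → Walk X 0 x x
  _▷_ : ∀ {k x y z} → Walk X k x y → X y z ≡ true → Walk X (suc k) x z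

HasStep : {A : Set} → (A → A → Bool) → A → Set
HasStep {A} X x = Σ A λ y → X x y ≡ true

≢true⇒false : ∀ {b} → ¬ (b ≡ true) → b ≡ false
≢true⇒false {true}  b≢true = ⊥-elim (b≢true refl)
≢true⇒false {false} _      = refl

module _ {A : Set} {X : A → A → Bool} where

  reindex : ∀ {m n x y} → m ≡ n → Walk X m x y → Walk X n x y
  reindex refl p = p

  infixr 5 _++_ _◁_
  _++_ : ∀ {a b x y z} → Walk X a x y → Walk X b y z → Walk X (a + b) x z
  _++_ {a} p [] = reindex (sym (+-identityʳ a)) p
  _++_ {a} {suc b} p (q ▷ s) = reindex (sym (+-suc a b)) ((p ++ q) ▷ s)

  _◁_ : ∀ {k x y z} → X x y ≡ true → Walk X k y z → Walk X (suc k) x z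
  s ◁ [] = [] ▷ s
  s ◁ (p ▷ s') = (s ◁ p) ▷ s'

  uncons : ∀ {k x z} → Walk X (suc k) x z → Σ A λ y → X x y ≡ true × Walk X k y z
  uncons ([] ▷ s) = _ , s , []
  uncons ((p ▷ s') ▷ s) with uncons (p ▷ s')
  ... | y , s₀ , q = y , s₀ , q ▷ s

  split : ∀ a b {x z} → Walk X (a + b) x z → Σ A λ y → Walk X a x y × Walk X b y z
  split a zero p = _ , reindex (+-identityʳ a) p , []
  split a (suc b) p with reindex (+-suc a b) p
  ... | q ▷ s with split a b q
  ...   | y , q₁ , q₂ = y , q₁ , q₂ ▷ s

  prefix : ∀ {a m x z} → a ≤ m → Walk X m x z → Σ A λ y → Walk X a x y
  prefix {a} a≤m p with m≤n⇒∃[o]m+o≡n a≤m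
  ... | b , refl with split a b p
  ...   | y , q , _ = y , q

  cut : ∀ {i j x z} → i < j → Walk X j x z →
        Σ A λ y → Walk X i x y × Σ ℕ λ k → Walk X (suc k) y z
  cut {i} i<j p with m≤n⇒∃[o]m+o≡n i<j
  ... | k , refl with split i (suc k) (reindex (sym (+-suc i k)) p)
  ...   | y , q₁ , q₂ = y , q₁ , k , q₂

module Walks {A : Set} (X : A → A → Bool) where

  Functional : Set
  Functional = ∀ x y z → X x y ≡ true → X x z ≡ true → y ≡ z

  Injective : Set
  Injective = ∀ x y z → X x z ≡ true → X y z ≡ true → x ≡ y

  deterministic : Functional → ∀ {k x y y'} → Walk X k x y → Walk X k x y' → y ≡ y'
  deterministic fun [] [] = refl
  deterministic fun (p ▷ s) (p' ▷ s') with deterministic fun p p'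
  ... | refl = fun _ _ _ s s'

  shorterExtends : Functional → ∀ {m m' x y y'} →
                   Walk X m x y → Walk X m' x y' → m < m' → HasStep X y
  shorterExtends fun p p' m<m' with cut m<m' p'
  ... | _ , q , _ , r with deterministic fun p q
  ...   | refl with uncons r
  ...     | w , s , _ = w , s

  stuckLength : Functional → ∀ {m m' x y y'} →
                Walk X m x y → ¬ HasStep X y → Walk X m' x y' → ¬ HasStep X y' → m ≡ m'
  stuckLength fun {m} {m'} p stuck p' stuck' with <-cmp m m'
  ... | tri< m<m' _ _ = ⊥-elim (stuck (shorterExtends fun p p' m<m'))
  ... | tri≈ _ m≡m' _ = m≡m'
  ... | tri> _ _ m>m' = ⊥-elim (stuck' (shorterExtends fun p' p m>m'))

  -- Along an injective relation, no cycle is reachable from a point without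
  -- predecessor: following both walks backwards would produce a predecessor.
  noCycleFromSource : Injective → ∀ {x} → (∀ y → ¬ (X y x ≡ true)) →
                      ∀ {s k q} → Walk X s x q → Walk X (suc k) q q → ⊥
  noCycleFromSource inj {x} source {s} p cyc = unequalLengths p (p ++ cyc) (m<m+n s (s≤s z≤n))
    where
    unequalLengths : ∀ {m n q} → Walk X m x q → Walk X n x q → m < n → ⊥
    unequalLengths [] (p' ▷ s') _ = source _ s'
    unequalLengths (p ▷ s) (p' ▷ s') (s≤s m<n) with inj _ _ _ s s'
    ... | refl = unequalLengths p p' m<n

  cycleThrough : Functional → ∀ {k c j z} →
                 Walk X (suc k) c c → Walk X j c z → Walk X (suc k) z z
  cycleThrough fun {k} {j = j} cyc p
    with split j (suc k) (reindex (+-comm (suc k) j) (cyc ++ p))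
  ... | y , p₁ , p₂ with deterministic fun p p₁
  ...   | refl = p₂

module Squares {A : Set} (H V : A → A → Bool) where

  Commute : Set
  Commute = ∀ x y z → H x y ≡ true → V x z ≡ true →
            Σ A λ w → (H z w ≡ true) × (V y w ≡ true)

  liftStep : Commute → ∀ {k x y z} → H x y ≡ true → Walk V k x z →
             Σ A λ w → Walk V k y w × H z w ≡ true
  liftStep com h [] = _ , [] , h
  liftStep com h (p ▷ s) with liftStep com h p
  ... | w' , p' , h' with com _ _ _ h' s
  ...   | w , h'' , s' = w , p' ▷ s' , h''

  liftWalk : Commute → ∀ {m k x y z} → Walk H m x y → Walk V k x z →
             Σ A λ w → Walk V k y w × Walk H m z w
  liftWalk com [] q = _ , q , []
  liftWalk com (p ▷ s) q with liftWalk com p q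
  ... | w' , q' , p' with liftStep com s q'
  ...   | w , q'' , h = w , q'' , p' ▷ h

  reverse : (∀ a b → H a b ≡ true → V b a ≡ true) →
            ∀ {k x y} → Walk H k x y → Walk V k y x
  reverse conv [] = []
  reverse conv (p ▷ s) = conv _ _ s ◁ reverse conv p

  propagate : (∀ x z → ¬ HasStep V x → H x z ≡ true → ¬ HasStep V z) →
              ∀ {k x z} → Walk H k x z → ¬ HasStep V x → ¬ HasStep V z
  propagate pres [] stuck = stuck
  propagate pres (p ▷ s) stuck = pres _ _ (propagate pres p stuck) s

commute-sym : ∀ {A : Set} {H V : A → A → Bool} → Squares.Commute H V → Squares.Commute V H
commute-sym com x y z v h with com x z y h v
... | w , h' , v' = w , v' , h'

module Powers {A : Set} where

  iterate : (A → A) → ℕ → A → A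
  iterate f zero x = x
  iterate f (suc k) x = f (iterate f k x)

  power : (f g : A → A) → ℤ → A → A
  power f g (+ k) = iterate f k
  power f g -[1+ k ] = iterate g (suc k)

  power-suc : ∀ (f g : A → A) → (∀ w → f (g w) ≡ w) →
              ∀ x w → power f g (x +ℤ 1ℤ) w ≡ f (power f g x w)
  power-suc f g fg (+ k) w = cong (λ m → iterate f m w) (+-comm k 1)
  power-suc f g fg -[1+ zero ] w = sym (fg w)
  power-suc f g fg -[1+ suc k ] w = sym (fg (iterate g (suc k) w))

  iterate-comm : ∀ (h f : A → A) → (∀ w → h (f w) ≡ f (h w)) →
                 ∀ k w → iterate f k (h w) ≡ h (iterate f k w)
  iterate-comm h f comm zero w = refl
  iterate-comm h f comm (suc k) w = trans (cong f (iterate-comm h f comm k w)) (sym (comm _))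

  power-comm : ∀ (h f g : A → A) →
               (∀ w → h (f w) ≡ f (h w)) → (∀ w → h (g w) ≡ g (h w)) →
               ∀ x w → power f g x (h w) ≡ h (power f g x w)
  power-comm h f g hf hg (+ k) w = iterate-comm h f hf k w
  power-comm h f g hf hg -[1+ k ] w = iterate-comm h g hg (suc k) w

  power-+ : ∀ (f g : A → A) → (∀ w → f (g w) ≡ w) →
            ∀ p x w → power f g (x +ℤ + p) w ≡ iterate f p (power f g x w)
  power-+ f g fg zero x w = cong (λ u → power f g u w) (ℤ.+-identityʳ x)
  power-+ f g fg (suc p) x w = begin
      power f g (x +ℤ + suc p) w       ≡⟨ cong (λ u → power f g u w) x+1+p ⟩
      power f g ((x +ℤ + p) +ℤ 1ℤ) w   ≡⟨ power-suc f g fg (x +ℤ + p) w ⟩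
      f (power f g (x +ℤ + p) w)       ≡⟨ cong f (power-+ f g fg p x w) ⟩
      iterate f (suc p) (power f g x w) ∎
    where
    open ≡-Reasoning
    x+1+p : x +ℤ + suc p ≡ (x +ℤ + p) +ℤ 1ℤ
    x+1+p = trans (cong (λ u → x +ℤ + u) (+-comm 1 p)) (sym (ℤ.+-assoc x (+ p) 1ℤ))

infixr 4 _⟨⟺⟩_
_⟨⟺⟩_ : ∀ {A B C : Set} → A ⟺ B → B ⟺ C → A ⟺ C
(f , g) ⟨⟺⟩ (f' , g') = f' ∘ f , g ∘ g'

⟺-sym : ∀ {A B : Set} → A ⟺ B → B ⟺ A
⟺-sym (f , g) = g , f

module GridCoordinates {A : Set} {xs ys : ℕ} (f : A → GridV xs ys) (x y : A → ℕ)
  (f-x : ∀ z → toℕ (proj₁ (f z)) ≡ x z)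
  (f-y : ∀ z → toℕ (proj₂ (f z)) ≡ y z) where

  gridL : ∀ u v → GridL (f u) (f v) ⟺ (x u ≡ suc (x v) × y u ≡ y v)
  gridL u v rewrite f-x u | f-x v | f-y u | f-y v = id , id

  gridR : ∀ u v → GridR (f u) (f v) ⟺ (x v ≡ suc (x u) × y v ≡ y u)
  gridR u v rewrite f-x u | f-x v | f-y u | f-y v = map₂ sym , map₂ sym

  gridU : ∀ u v → GridU (f u) (f v) ⟺ (x u ≡ x v × y u ≡ suc (y v))
  gridU u v rewrite f-x u | f-x v | f-y u | f-y v = id , id

  gridD : ∀ u v → GridD (f u) (f v) ⟺ (x v ≡ x u × y v ≡ suc (y u))
  gridD u v rewrite f-x u | f-x v | f-y u | f-y v = map₁ sym , map₁ sym

module _ {t : ℕ} (G : Structure t) where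
  open Structure G
  open Walks
  open Squares
  open Powers

  Rel : Set
  Rel = Carrier → Carrier → Bool

  hasStep? : (X : Rel) → ∀ x → Dec (Def G X x)
  hasStep? X x = any? (λ y → X x y ≟ᵇ true)

  everywhere : (X : Rel) → ¬ (Σ Carrier λ x → ¬ Def G X x) → ∀ x → Def G X x
  everywhere X noStuck x with hasStep? X x
  ... | yes d = d
  ... | no nd = ⊥-elim (noStuck (x , nd))

  run : (X : Rel) → ∀ N x →
        (Σ ℕ λ m → Σ Carrier λ e → Walk X m x e × ¬ Def G X e) ⊎
        (Σ Carrier λ e → Walk X N x e)
  run X zero x = inj₂ (x , [])
  run X (suc N) x with run X N x
  ... | inj₁ stuck = inj₁ stuck
  ... | inj₂ (e , p) with hasStep? X e
  ...   | yes (e' , s) = inj₂ (e' , p ▷ s)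
  ...   | no stuck = inj₁ (N , e , p , stuck)

  -- In the finite structure G, following a partial function from x either gets
  -- stuck or reaches a cycle (pigeonhole on the first |G| + 1 points).
  trajectory : (X : Rel) → Functional X → ∀ x →
    (Σ ℕ λ m → Σ Carrier λ e → Walk X m x e × ¬ Def G X e) ⊎
    (Σ ℕ λ s → Σ Carrier λ q → Σ ℕ λ k → Walk X s x q × Walk X (suc k) q q)
  trajectory X fun x with run X (suc (suc n)) x
  ... | inj₁ stuck = inj₁ stuck
  ... | inj₂ (_ , p) = inj₂ (repeat (pigeonhole ≤-refl point))
    where
    point : Fin (suc (suc n)) → Carrier
    point i = proj₁ (prefix (<⇒≤ (toℕ<n i)) p)
    walkTo : ∀ i → Walk X (toℕ i) x (point i)
    walkTo i = proj₂ (prefix (<⇒≤ (toℕ<n i)) p)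
    repeat : (Σ (Fin (suc (suc n))) λ i → Σ (Fin (suc (suc n))) λ j →
                toℕ i < toℕ j × point i ≡ point j) →
             Σ ℕ λ s → Σ Carrier λ q → Σ ℕ λ k → Walk X s x q × Walk X (suc k) q q
    repeat (i , j , i<j , same) with cut i<j (walkTo j)
    ... | _ , q , k , r with deterministic X fun (walkTo i) q
    ...   | refl = toℕ i , point i , k , walkTo i , subst (Walk X _ _) (sym same) r

  -- Columns are orbits of Next; Low and High move to the
  -- neighbouring less or more significant column.  The bit of w changes from w
  -- to Next(w) iff w is in the least significant column or the column below
  -- carries (bit 0 at Low(w), bit 1 at Next(Low(w))); the most significant
  -- column holds 0.  Prev is the converse of Next.
  module Counter (Next Prev Low High : Rel) (bit : Carrier → Bool)
    (funNext : Functional Next) (funLow : Functional Low)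
    (next⇒prev : ∀ x y → Next x y ≡ true → Prev y x ≡ true)
    (high⇒low : ∀ x y → High x y ≡ true → Low y x ≡ true)
    (low⇒high : ∀ x y → Low x y ≡ true → High y x ≡ true)
    (comHighNext : Commute High Next) (comHighPrev : Commute High Prev)
    (comLowNext : Commute Low Next)
    (toggle : ∀ w → Def G Next w →
      (¬ ((bit w ≡ true) ⟺ At1 G bit Next w)) ⟺
      (¬ Def G Low w ⊎ (¬ At1 G bit Low w × At2 G bit Low Next w)))
    (top : ∀ x → ¬ Def G High x → ¬ (bit x ≡ true))
    where

    Constant : Carrier → Set
    Constant c = ∀ {j z z'} → Walk Next j c z → Next z z' ≡ true → bit z ≡ bit z'

    NoRise : Carrier → Set
    NoRise c = ∀ {j z z'} → Walk Next j c z → Next z z' ≡ true →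
               bit z' ≡ true → bit z ≡ true

    unchanged⇒iff : ∀ {w w'} → Next w w' ≡ true → bit w ≡ bit w' →
                    (bit w ≡ true) ⟺ At1 G bit Next w
    unchanged⇒iff next same =
      (λ set → _ , next , trans (sym same) set) ,
      λ { (y , next' , set) →
            trans same (subst (λ u → bit u ≡ true) (funNext _ _ _ next' next) set) }

    topConstant : ∀ {q} → ¬ Def G High q → Constant q
    topConstant noHigh p next =
      trans (≢true⇒false (top _ atZ)) (sym (≢true⇒false (top _ (stillTop _ _ atZ next))))
      where
      stillTop : ∀ x z → ¬ Def G High x → Next x z ≡ true → ¬ Def G High z
      stillTop x z noHighX next' (w , high) with comHighPrev z w x high (next⇒prev x z next')
      ... | w' , highX , _ = noHighX (w' , highX)
      atZ = propagate Next High stillTop p noHigh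

    noRise : ∀ {p e} → Low p e ≡ true → Constant p → NoRise e
    noRise low constP {z = z} {z'} pz next set' with bit z in bitZ
    ... | true = refl
    ... | false with liftStep High Next comHighNext (low⇒high _ _ low) pz
    ...   | w , pw , highZ with comHighNext z w z' highZ next
    ...     | w' , _ , nextW =
      ⊥-elim (proj₂ (toggle w (w' , nextW)) (inj₂ (lowUnset , carry))
                    (unchanged⇒iff nextW (constP pw nextW)))
      where
      lowUnset : ¬ At1 G bit Low w
      lowUnset (y , lowY , setY) with funLow _ _ _ lowY (high⇒low _ _ highZ)
      ... | refl with trans (sym bitZ) setY
      ...   | ()
      carry : At2 G bit Low Next w
      carry = z , z' , high⇒low _ _ highZ , next , set'

    backwards : ∀ {e} → NoRise e → ∀ {j a l b} →
                Walk Next j e a → Walk Next l a b → bit b ≡ true → bit a ≡ true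
    backwards rise pa [] set = set
    backwards rise pa (q ▷ s) set = backwards rise pa q (rise (pa ++ q) s set)

    -- On a cycle without rises the bit is constant: a step 1 → 0 would force
    -- the bit to be 1 all the way around the cycle.
    noRise⇒constant : ∀ {e k} → Walk Next (suc k) e e → NoRise e → Constant e
    noRise⇒constant cyc rise {z = z} {z'} pz next with bit z' in bitZ'
    ... | true = rise pz next bitZ'
    ... | false with bit z in bitZ
    ...   | false = refl
    ...   | true with uncons (cycleThrough Next funNext cyc pz)
    ...     | _ , nextY , back with funNext _ _ _ nextY next
    ...       | refl with trans (sym bitZ') (backwards rise (pz ▷ next) back bitZ)
    ...         | ()

    -- The least significant column toggles at every step, so it is not
    -- constant, as soon as it has a step at all.
    bottomToggles : ∀ {e k} → ¬ Def G Low e → Walk Next (suc k) e e → ¬ Constant e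
    bottomToggles noLow cyc constE with uncons cyc
    ... | e' , next , _ =
      proj₂ (toggle _ (e' , next)) (inj₁ noLow) (unchanged⇒iff next (constE [] next))

    -- A counter whose most significant column is a cycle cannot have a least
    -- significant column: all columns would be constant cycles.
    noCycle : ∀ {m q e k} → ¬ Def G High q → Walk Next (suc k) q q →
              Walk Low m q e → ¬ Def G Low e → ⊥
    noCycle {q = q} {k = k} noHigh cyc pl noLow =
      bottomToggles noLow (cycleAt pl) (constant pl)
      where
      cycleAt : ∀ {i c} → Walk Low i q c → Walk Next (suc k) c c
      cycleAt p with liftWalk Low Next comLowNext p cyc
      ... | _ , pw , p' with deterministic Low funLow p p'
      ...   | refl = pw
      constant : ∀ {i c} → Walk Low i q c → Constant c
      constant [] = topConstant noHigh
      constant (p ▷ s) = noRise⇒constant (cycleAt (p ▷ s)) (noRise s (constant p))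

  module Model {TR TD : Fin t → Fin t → Bool} (φ₂ : Phi2 G TR TD) where
    open Phi2 φ₂
    open Phi1 phi1

    r⇒l : ∀ x y → R x y ≡ true → L y x ≡ true
    r⇒l x y = proj₁ (invRL x y)
    l⇒r : ∀ x y → L x y ≡ true → R y x ≡ true
    l⇒r x y = proj₂ (invRL y x)
    u⇒d : ∀ x y → U x y ≡ true → D y x ≡ true
    u⇒d x y = proj₁ (invUD x y)
    d⇒u : ∀ x y → D x y ≡ true → U y x ≡ true
    d⇒u x y = proj₂ (invUD y x)

    injR : Injective R
    injR a b c r₁ r₂ = pfL c a b (r⇒l _ _ r₁) (r⇒l _ _ r₂)
    injL : Injective L
    injL a b c l₁ l₂ = pfR c a b (l⇒r _ _ l₁) (l⇒r _ _ l₂)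
    injU : Injective U
    injU a b c u₁ u₂ = pfD c a b (u⇒d _ _ u₁) (u⇒d _ _ u₂)
    injD : Injective D
    injD a b c d₁ d₂ = pfU c a b (d⇒u _ _ d₁) (d⇒u _ _ d₂)

    noL⇒sourceR : ∀ {x} → ¬ Def G L x → ∀ y → ¬ (R y x ≡ true)
    noL⇒sourceR noL y r = noL (y , r⇒l _ _ r)
    noU⇒sourceD : ∀ {x} → ¬ Def G U x → ∀ y → ¬ (D y x ≡ true)
    noU⇒sourceD noU y d = noU (y , d⇒u _ _ d)

    leftEdge-U : ∀ x z → ¬ Def G L x → U x z ≡ true → ¬ Def G L z
    leftEdge-U x z noL u (w , l) with comLD z w x l (u⇒d _ _ u)
    ... | w' , l' , _ = noL (w' , l')
    leftEdge-D : ∀ x z → ¬ Def G L x → D x z ≡ true → ¬ Def G L z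
    leftEdge-D x z noL d (w , l) with comLU z w x l (d⇒u _ _ d)
    ... | w' , l' , _ = noL (w' , l')
    topEdge-R : ∀ x z → ¬ Def G U x → R x z ≡ true → ¬ Def G U z
    topEdge-R x z noU r (w , u) with comLU z x w (r⇒l _ _ r) u
    ... | w' , _ , u' = noU (w' , u')
    topEdge-L : ∀ x z → ¬ Def G U x → L x z ≡ true → ¬ Def G U z
    topEdge-L x z noU l (w , u) with comRU z x w (l⇒r _ _ l) u
    ... | w' , _ , u' = noU (w' , u')

    -- B_V is a counter along columns (going up, least significant column on
    -- the left); B_H is a counter along rows (going right, least significant
    -- row at the bottom).
    horizontalCounter : ∀ {m q e k} → ¬ Def G R q → Walk U (suc k) q q →
                        Walk L m q e → ¬ Def G L e → ⊥
    horizontalCounter = Counter.noCycle U D L R BV pfU pfL u⇒d r⇒l l⇒r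
                          comRU comRD comLU hc2 hc3

    verticalCounter : ∀ {m q e k} → ¬ Def G U q → Walk R (suc k) q q →
                      Walk D m q e → ¬ Def G D e → ⊥
    verticalCounter = Counter.noCycle R L D U BH pfR pfD r⇒l u⇒d d⇒u
                        (commute-sym comRU) (commute-sym comLU) (commute-sym comRD) vc2 vc3

    tileOf : Carrier → Fin t
    tileOf v = proj₁ (tiled v)

    true-by-contradiction : ∀ {b} → ¬ ¬ (b ≡ true) → b ≡ true
    true-by-contradiction {true} _ = refl
    true-by-contradiction {false} nn = ⊥-elim (nn λ ())

    tileR : ∀ {v w} → R v w ≡ true → TR (tileOf v) (tileOf w) ≡ true
    tileR {v} {w} r = true-by-contradiction λ bad →
      correctR _ _ bad (v , w , r , proj₂ (tiled v) , proj₂ (tiled w))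
    tileD : ∀ {v w} → D v w ≡ true → TD (tileOf v) (tileOf w) ≡ true
    tileD {v} {w} d = true-by-contradiction λ bad →
      correctD _ _ bad (v , w , d , proj₂ (tiled v) , proj₂ (tiled w))

    surjective : (X : Rel) → Functional X → Injective X → (∀ x → Def G X x) →
                 ∀ z → Σ Carrier λ y → X y z ≡ true
    surjective X fun inj total z with any? (λ y → X y z ≟ᵇ true)
    ... | yes pre = pre
    ... | no noPre with trajectory X fun z
    ...   | inj₁ (_ , e , _ , stuck) = ⊥-elim (stuck (total e))
    ...   | inj₂ (_ , _ , _ , p , cyc) =
      ⊥-elim (noCycleFromSource X inj (λ y s → noPre (y , s)) p cyc)

    module Fn (X : Rel) (fun : Functional X) (total : ∀ x → Def G X x) where
      apply : Carrier → Carrier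
      apply x = proj₁ (total x)
      step : ∀ x → X x (apply x) ≡ true
      step x = proj₂ (total x)
      unique : ∀ {x y} → X x y ≡ true → apply x ≡ y
      unique = fun _ _ _ (step _)
      walk⇒iterate : ∀ {j x y} → Walk X j x y → iterate apply j x ≡ y
      walk⇒iterate [] = refl
      walk⇒iterate (p ▷ s) = unique (subst (λ u → X u _ ≡ true) (sym (walk⇒iterate p)) s)

    -- If L and U are total, G is a torus: starting at a point of a cycle of R
    -- and applying powers of R and D yields a periodic tiling of the plane.
    module Torus (totalL : ∀ x → Def G L x) (totalU : ∀ x → Def G U x) where
      totalR : ∀ x → Def G R x
      totalR x = let (y , l) = surjective L pfL injL totalL x in y , l⇒r _ _ l
      totalD : ∀ x → Def G D x
      totalD x = let (y , u) = surjective U pfU injU totalU x in y , u⇒d _ _ u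

      open Fn R pfR totalR renaming (apply to right; step to stepR; unique to uniqueR)
      open Fn L pfL totalL renaming (apply to left; step to stepL; unique to uniqueL)
        hiding (walk⇒iterate)
      open Fn U pfU totalU renaming (apply to up; step to stepU; unique to uniqueU)
        hiding (walk⇒iterate)
      open Fn D pfD totalD renaming (apply to down; step to stepD; unique to uniqueD)
        hiding (walk⇒iterate)

      right-left : ∀ w → right (left w) ≡ w
      right-left w = uniqueR (l⇒r _ _ (stepL w))
      left-right : ∀ w → left (right w) ≡ w
      left-right w = uniqueL (r⇒l _ _ (stepR w))
      down-up : ∀ w → down (up w) ≡ w
      down-up w = uniqueD (u⇒d _ _ (stepU w))

      right-down : ∀ w → right (down w) ≡ down (right w)
      right-down w with comRD w (right w) (down w) (stepR w) (stepD w)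
      ... | _ , r , d = trans (uniqueR r) (sym (uniqueD d))
      right-up : ∀ w → right (up w) ≡ up (right w)
      right-up w with comRU w (right w) (up w) (stepR w) (stepU w)
      ... | _ , r , u = trans (uniqueR r) (sym (uniqueU u))

      at : Carrier → ℤ → ℤ → Carrier
      at q x y = power down up y (power right left x q)

      at-right : ∀ q x y → at q (x +ℤ 1ℤ) y ≡ right (at q x y)
      at-right q x y = trans (cong (power down up y) (power-suc right left right-left x q))
                             (power-comm right down up right-down right-up y _)

      at-down : ∀ q x y → at q x (y +ℤ 1ℤ) ≡ down (at q x y)
      at-down q x y = power-suc down up down-up y _

      at-period : ∀ q k → Walk R (suc k) q q →
                  ∀ x → power right left (x +ℤ + suc k) q ≡ power right left x q
      at-period q k cyc x = begin
          power right left (x +ℤ + suc k) q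
            ≡⟨ power-+ right left right-left (suc k) x q ⟩
          iterate right (suc k) (power right left x q)
            ≡⟨ iterate-comm (power right left x) right commutes (suc k) q ⟩
          power right left x (iterate right (suc k) q)
            ≡⟨ cong (power right left x) (walk⇒iterate cyc) ⟩
          power right left x q ∎
        where
        open ≡-Reasoning
        commutes : ∀ w → power right left x (right w) ≡ right (power right left x w)
        commutes = power-comm right right left (λ _ → refl)
                     (λ w → trans (right-left w) (sym (left-right w))) x

      periodicTiling : Σ (ℤ → ℤ → Fin t) λ C → IsTiling TR TD C × Periodic C
      periodicTiling with trajectory R pfR fzero
      ... | inj₁ (_ , e , _ , stuck) = ⊥-elim (stuck (totalR e))
      ... | inj₂ (_ , q , k , _ , cyc) = C , tiling , period
        where
        C : ℤ → ℤ → Fin t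
        C x y = tileOf (at q x y)
        tiling : IsTiling TR TD C
        tiling x y =
          subst (λ u → TR (C x y) (tileOf u) ≡ true) (sym (at-right q x y)) (tileR (stepR _)) ,
          subst (λ u → TD (C x y) (tileOf u) ≡ true) (sym (at-down q x y)) (tileD (stepD _))
        period : Periodic C
        period = + suc k , 0ℤ , (λ { (() , _) }) , λ x y →
          cong₂ (λ y' h → tileOf (power down up y' h))
                (sym (ℤ.+-identityʳ y)) (sym (at-period q k cyc x))

    Aperiodic : Set
    Aperiodic = ∀ C → IsTiling TR TD C → ¬ Periodic C

    -- A point q without L-neighbour does not lie on a U-cycle: its row ends at
    -- some r, the column of r is a U-cycle too, and the horizontal counter on
    -- the columns from r back to q is impossible.
    leftEdge-noUCycle : ∀ {q k} → ¬ Def G L q → Walk U (suc k) q q → ⊥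
    leftEdge-noUCycle {q} noL cyc with trajectory R pfR q
    ... | inj₂ (_ , _ , _ , p , cyc') = noCycleFromSource R injR (noL⇒sourceR noL) p cyc'
    ... | inj₁ (_ , r , pr , noR) with liftWalk R U comRU pr cyc
    ...   | _ , cycR , pr' with deterministic R pfR pr pr'
    ...     | refl = horizontalCounter noR cycR (reverse R L r⇒l pr) noL

    topEdge-noLCycle : ∀ {q k} → ¬ Def G U q → Walk L (suc k) q q → ⊥
    topEdge-noLCycle {q} noU cyc with trajectory D pfD q
    ... | inj₂ (_ , _ , _ , p , cyc') = noCycleFromSource D injD (noU⇒sourceD noU) p cyc'
    ... | inj₁ (_ , _ , pd , noD) = verticalCounter noU (reverse L R l⇒r cyc) pd noD

    Corner : Set
    Corner = Σ Carrier λ o → ¬ Def G L o × ¬ Def G U o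

    cornerAbove : ∀ {y₀} → ¬ Def G L y₀ → Corner
    cornerAbove {y₀} noL with trajectory U pfU y₀
    ... | inj₁ (_ , e , p , noU) = e , propagate U L leftEdge-U p noL , noU
    ... | inj₂ (_ , _ , _ , p , cyc) =
      ⊥-elim (leftEdge-noUCycle (propagate U L leftEdge-U p noL) cyc)

    -- If L is total, no point lacks a U-neighbour: walking left from it would
    -- close an L-cycle along the top edge.
    totalL⇒totalU : (∀ x → Def G L x) → ∀ x → ¬ ¬ Def G U x
    totalL⇒totalU totalL x₀ noU with trajectory L pfL x₀
    ... | inj₁ (_ , e , _ , stuck) = stuck (totalL e)
    ... | inj₂ (_ , _ , _ , p , cyc) = topEdge-noLCycle (propagate L U topEdge-L p noU) cyc

    corner : Aperiodic → Corner
    corner aperiodic with any? (λ x → ¬? (hasStep? L x))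
    ... | yes (_ , noL) = cornerAbove noL
    ... | no noStuckL =
      let (C , tiling , period) = Torus.periodicTiling totalL totalU in
      ⊥-elim (aperiodic C tiling period)
      where
      totalL : ∀ x → Def G L x
      totalL = everywhere L noStuckL
      totalU : ∀ x → Def G U x
      totalU = everywhere U (λ { (x , noU) → totalL⇒totalU totalL x noU })

    module Rectangle (o : Carrier) (noLo : ¬ Def G L o) (noUo : ¬ Def G U o)
                     (connected : GaifmanConnected G) where

      topRow : Σ ℕ λ a → Σ Carrier λ r → Walk R a o r × ¬ Def G R r
      topRow with trajectory R pfR o
      ... | inj₁ end = end
      ... | inj₂ (_ , _ , _ , p , cyc) =
        ⊥-elim (noCycleFromSource R injR (noL⇒sourceR noLo) p cyc)

      leftColumn : Σ ℕ λ b → Σ Carrier λ e → Walk D b o e × ¬ Def G D e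
      leftColumn with trajectory D pfD o
      ... | inj₁ end = end
      ... | inj₂ (_ , _ , _ , p , cyc) =
        ⊥-elim (noCycleFromSource D injD (noU⇒sourceD noUo) p cyc)

      a : ℕ
      a = proj₁ topRow
      topRight : Carrier
      topRight = proj₁ (proj₂ topRow)
      alongTop : Walk R a o topRight
      alongTop = proj₁ (proj₂ (proj₂ topRow))
      topRight-stuck : ¬ Def G R topRight
      topRight-stuck = proj₂ (proj₂ (proj₂ topRow))

      b : ℕ
      b = proj₁ leftColumn
      bottomLeft : Carrier
      bottomLeft = proj₁ (proj₂ leftColumn)
      alongLeft : Walk D b o bottomLeft
      alongLeft = proj₁ (proj₂ (proj₂ leftColumn))
      bottomLeft-stuck : ¬ Def G D bottomLeft
      bottomLeft-stuck = proj₂ (proj₂ (proj₂ leftColumn))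

      At : ℕ → ℕ → Carrier → Set
      At i j z = Σ Carrier λ c → Walk D j o c × Walk R i c z

      onLeftEdge : ∀ {j c} → Walk D j o c → ¬ Def G L c
      onLeftEdge p = propagate D L leftEdge-D p noLo

      onTopEdge : ∀ {i w} → Walk R i o w → ¬ Def G U w
      onTopEdge p = propagate R U topEdge-R p noUo

      leftToEdge : ∀ {i j z} → At i j z → Σ Carrier λ c → Walk L i z c × ¬ Def G L c
      leftToEdge (c , pd , pr) = c , reverse R L r⇒l pr , onLeftEdge pd

      upToEdge : ∀ {i j z} → At i j z →
                 Σ Carrier λ w → Walk U j z w × ¬ Def G U w × Walk R i o w
      upToEdge (c , pd , pr) with liftWalk R U comRU pr (reverse D U d⇒u pd)
      ... | w , pu , pr' = w , pu , onTopEdge pr' , pr'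

      at-coordinates-unique : ∀ {i j i' j' z} → At i j z → At i' j' z → i ≡ i' × j ≡ j'
      at-coordinates-unique p p'
        with leftToEdge p | leftToEdge p' | upToEdge p | upToEdge p'
      ... | _ , l , noL | _ , l' , noL' | _ , u , noU , _ | _ , u' , noU' , _ =
        stuckLength L pfL l noL l' noL' , stuckLength U pfU u noU u' noU'

      at-point-unique : ∀ {i j z z'} → At i j z → At i j z' → z ≡ z'
      at-point-unique (c , pd , pr) (c' , pd' , pr') with deterministic D pfD pd pd'
      ... | refl = deterministic R pfR pr pr'

      toRight : ∀ {i j z z'} → At i j z → R z z' ≡ true → At (suc i) j z'
      toRight (c , pd , pr) r = c , pd , pr ▷ r

      toDown : ∀ {i j z z'} → At i j z → D z z' ≡ true → At i (suc j) z'
      toDown (c , pd , pr) d with liftStep D L (commute-sym comLD) d (reverse R L r⇒l pr)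
      ... | w , pl , d' = w , pd ▷ d' , reverse L R l⇒r pl

      leftOf : ∀ {i j z} → At (suc i) j z → Σ Carrier λ w → L z w ≡ true × At i j w
      leftOf (c , pd , pr ▷ r) = _ , r⇒l _ _ r , (c , pd , pr)

      aboveOf : ∀ {i j z} → At i (suc j) z → Σ Carrier λ w → U z w ≡ true × At i j w
      aboveOf (c , pd ▷ d , pr) with liftStep U R (commute-sym comRU) (d⇒u _ _ d) pr
      ... | _ , pr' , u = _ , u , (_ , pd , pr')

      toLeft : ∀ {i j z z'} → At i j z → L z z' ≡ true →
               Σ ℕ λ i' → i ≡ suc i' × At i' j z'
      toLeft (c , pd , []) l = ⊥-elim (onLeftEdge pd (_ , l))
      toLeft (c , pd , pr ▷ r) l with pfL _ _ _ (r⇒l _ _ r) l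
      ... | refl = _ , refl , (c , pd , pr)

      toUp : ∀ {i j z z'} → At i j z → U z z' ≡ true →
             Σ ℕ λ j' → j ≡ suc j' × At i j' z'
      toUp (c , [] , pr) u = ⊥-elim (onTopEdge pr (_ , u))
      toUp p@(_ , _ ▷ _ , _) u with aboveOf p
      ... | _ , u' , p' with pfU _ _ _ u' u
      ...   | refl = _ , refl , p'

      rightEdge : ∀ {j z} → At a j z → ¬ Def G R z
      rightEdge p (y , r) with upToEdge p
      ... | _ , pu , _ , pr with deterministic R pfR alongTop pr
      ...   | refl with liftStep R U comRU r pu
      ...     | w , _ , r' = topRight-stuck (w , r')

      bottomEdge : ∀ {i z} → At i b z → ¬ Def G D z
      bottomEdge (c , pd , pr) (y , d) with deterministic D pfD alongLeft pd
      ... | refl with liftStep D L (commute-sym comLD) d (reverse R L r⇒l pr)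
      ...   | w , _ , d' = bottomLeft-stuck (w , d')

      record Coordinates (z : Carrier) : Set where
        constructor coordinates
        field
          col row : ℕ
          col≤a : col ≤ a
          row≤b : row ≤ b
          at : At col row z
      open Coordinates

      moveL : ∀ {z z'} → Coordinates z → L z z' ≡ true → Coordinates z'
      moveL (coordinates i j i≤a j≤b p) l with toLeft p l
      ... | i' , refl , p' = coordinates i' j (<⇒≤ i≤a) j≤b p'
      moveU : ∀ {z z'} → Coordinates z → U z z' ≡ true → Coordinates z'
      moveU (coordinates i j i≤a j≤b p) u with toUp p u
      ... | j' , refl , p' = coordinates i j' i≤a (<⇒≤ j≤b) p'
      moveR : ∀ {z z'} → Coordinates z → R z z' ≡ true → Coordinates z'
      moveR (coordinates i j i≤a j≤b p) r with i ≟ a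
      ... | yes refl = ⊥-elim (rightEdge p (_ , r))
      ... | no i≢a = coordinates (suc i) j (≤∧≢⇒< i≤a i≢a) j≤b (toRight p r)
      moveD : ∀ {z z'} → Coordinates z → D z z' ≡ true → Coordinates z'
      moveD (coordinates i j i≤a j≤b p) d with j ≟ b
      ... | yes refl = ⊥-elim (bottomEdge p (_ , d))
      ... | no j≢b = coordinates i (suc j) i≤a (≤∧≢⇒< j≤b j≢b) (toDown p d)

      move : ∀ {z z'} → Coordinates z → Adj G z z' → Coordinates z'
      move c (inj₁ (inj₁ l)) = moveL c l
      move c (inj₁ (inj₂ (inj₁ r))) = moveR c r
      move c (inj₁ (inj₂ (inj₂ (inj₁ u)))) = moveU c u
      move c (inj₁ (inj₂ (inj₂ (inj₂ d)))) = moveD c d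
      move c (inj₂ (inj₁ l)) = moveR c (l⇒r _ _ l)
      move c (inj₂ (inj₂ (inj₁ r))) = moveL c (r⇒l _ _ r)
      move c (inj₂ (inj₂ (inj₂ (inj₁ u)))) = moveD c (u⇒d _ _ u)
      move c (inj₂ (inj₂ (inj₂ (inj₂ d)))) = moveU c (d⇒u _ _ d)

      moves : ∀ {z z'} → Star (Adj G) z z' → Coordinates z → Coordinates z'
      moves ε c = c
      moves (s ◅ ss) c = moves ss (move c s)

      coordinatesOf : ∀ z → Coordinates z
      coordinatesOf z = moves (connected o z) (coordinates 0 0 z≤n z≤n (o , [] , []))

      pointAt : ∀ {i j} → i ≤ a → j ≤ b → Σ Carrier λ z → At i j z
      pointAt i≤a j≤b with prefix j≤b alongLeft
      ... | c , pd with liftWalk R D comRD alongTop pd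
      ...   | _ , _ , pr with prefix i≤a pr
      ...     | z , pr' = z , (c , pd , pr')

      ci cj : Carrier → ℕ
      ci z = col (coordinatesOf z)
      cj z = row (coordinatesOf z)

      atOf : ∀ z → At (ci z) (cj z) z
      atOf z = at (coordinatesOf z)

      to : Carrier → GridV a b
      to z = fromℕ< (s≤s (col≤a (coordinatesOf z))) ,
             fromℕ< (s≤s (row≤b (coordinatesOf z)))

      from : GridV a b → Carrier
      from (x , y) = proj₁ (pointAt (≤-pred (toℕ<n x)) (≤-pred (toℕ<n y)))

      atFrom : ∀ g → At (toℕ (proj₁ g)) (toℕ (proj₂ g)) (from g)
      atFrom (x , y) = proj₂ (pointAt (≤-pred (toℕ<n x)) (≤-pred (toℕ<n y)))

      to-col : ∀ z → toℕ (proj₁ (to z)) ≡ ci z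
      to-col z = toℕ-fromℕ< _
      to-row : ∀ z → toℕ (proj₂ (to z)) ≡ cj z
      to-row z = toℕ-fromℕ< _

      iso : Carrier ↔ GridV a b
      iso = mk↔ₛ′ to from to-from from-to
        where
        to-from : ∀ g → to (from g) ≡ g
        to-from g = cong₂ _,_ (toℕ-injective (trans (to-col (from g)) (proj₁ same)))
                              (toℕ-injective (trans (to-row (from g)) (proj₂ same)))
          where
          same : ci (from g) ≡ toℕ (proj₁ g) × cj (from g) ≡ toℕ (proj₂ g)
          same = at-coordinates-unique (atOf (from g)) (atFrom g)
        from-to : ∀ z → from (to z) ≡ z
        from-to z = at-point-unique
          (subst₂ (λ i j → At i j (from (to z))) (to-col z) (to-row z) (atFrom (to z))) (atOf z)

      L-coordinates : ∀ u v → (L u v ≡ true) ⟺ (ci u ≡ suc (ci v) × cj u ≡ cj v)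
      L-coordinates u v = forward , backward
        where
        forward : L u v ≡ true → ci u ≡ suc (ci v) × cj u ≡ cj v
        forward l with toLeft (atOf u) l
        ... | _ , i≡ , p with at-coordinates-unique p (atOf v)
        ...   | i'≡ , j≡ = trans i≡ (cong suc i'≡) , j≡
        backward : ci u ≡ suc (ci v) × cj u ≡ cj v → L u v ≡ true
        backward (i≡ , j≡) with leftOf (subst (λ i → At i (cj u) u) i≡ (atOf u))
        ... | _ , l , p with at-point-unique p (subst (λ j → At (ci v) j v) (sym j≡) (atOf v))
        ...   | refl = l

      U-coordinates : ∀ u v → (U u v ≡ true) ⟺ (ci u ≡ ci v × cj u ≡ suc (cj v))
      U-coordinates u v = forward , backward
        where
        forward : U u v ≡ true → ci u ≡ ci v × cj u ≡ suc (cj v)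
        forward s with toUp (atOf u) s
        ... | _ , j≡ , p with at-coordinates-unique p (atOf v)
        ...   | i≡ , j'≡ = i≡ , trans j≡ (cong suc j'≡)
        backward : ci u ≡ ci v × cj u ≡ suc (cj v) → U u v ≡ true
        backward (i≡ , j≡) with aboveOf (subst (λ j → At (ci u) j u) j≡ (atOf u))
        ... | _ , s , p with at-point-unique p (subst (λ i → At i (cj v) v) (sym i≡) (atOf v))
        ...   | refl = s

      open GridCoordinates to ci cj to-col to-row

      isGrid : IsoToGrid G
      isGrid = a , b , iso , λ u v →
        (L-coordinates u v ⟨⟺⟩ ⟺-sym (gridL u v)) ,
        (invRL u v ⟨⟺⟩ L-coordinates v u ⟨⟺⟩ ⟺-sym (gridR u v)) ,
        (U-coordinates u v ⟨⟺⟩ ⟺-sym (gridU u v)) ,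
        (⟺-sym (invUD v u) ⟨⟺⟩ U-coordinates v u ⟨⟺⟩ ⟺-sym (gridD u v))

    gridIsomorphism : Aperiodic → GaifmanConnected G → IsoToGrid G
    gridIsomorphism aperiodic connected =
      let (o , noL , noU) = corner aperiodic in Rectangle.isGrid o noL noU connected

theorem3 : ∀ {t} (TR TD : Fin t → Fin t → Bool)
    → Σ (ℤ → ℤ → Fin t) (λ C → IsTiling TR TD C)
    → (∀ C → IsTiling TR TD C → ¬ Periodic C)
    → (G : Structure t) → Phi2 G TR TD → GaifmanConnected G
    → IsoToGrid G
theorem3 TR TD _ aperiodic G φ₂ connected = Model.gridIsomorphism G φ₂ aperiodic connected
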